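{- Let $\lambda$ be the partially ordered pattern of size 4 whose only relations are $1>2$ and $1>4$, and for $m\geq 0$ write $a_m=|Av_m(\lambda)|$ (with $a_0=1$). Then for all $n\geq 4$, \[ a_n = 2n-3 + a_{n-1} + \sum_{i=2}^{n-1}(2i-3)\, a_{n-i}. \]
   Context: A permutation of length $n$ ($n$-permutation) is written $\pi=\pi_1\pi_2\cdots\pi_n$. A partially ordered pattern (POP) of size $k$ is a poset on the set $\{1,\dots,k\}$; an $n$-permutation $\pi$ contains it if there are indices $i_1<i_2<\cdots<i_k$ such that $\pi_{i_a}<\pi_{i_b}$ whenever $a<b$ in the poset, and avoids it otherwise. Thus $\pi$ contains $\lambda$ iff there are $i_1<i_2<i_3<i_4$ with $\pi_{i_1}>\pi_{i_2}$ and $\pi_{i_1}>\pi_{i_4}$. $Av_n(\lambda)$ denotes the set of $n$-permutations avoiding $\lambda$. -}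

module Defs where

open import Data.Nat using (ℕ; _+_; _*_; _∸_; _<_)
open import Data.Fin using (Fin; zero; suc) renaming (_<_ to _<ᶠ_)
open import Data.Vec using (Vec; lookup; toList)
open import Data.List using (List; length; map; upTo)
open import Data.Nat.ListAction using (sum)
open import Data.Empty using (⊥)
open import Data.List.Relation.Unary.Unique.Propositional using (Unique)
open import Data.List.Membership.Propositional using (_∈_)
open import Data.Product using (Σ; ∃; _×_)
open import Data.Sum using (_⊎_)
open import Function.Bundles using (_⇔_)
open import Relation.Binary.PropositionalEquality using (_≡_)

-- An n-permutation π = π₁…πₙ is a word over Fin n (values 0..n-1) with
-- pairwise distinct entries (hence a bijection); πᵢ = lookup π (i-1).
IsPerm : {n : ℕ} → Vec (Fin n) n → Set
IsPerm π = Unique (toList π)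

-- A partially ordered pattern of size k, given by its (strict) order
-- relation on positions: R a b means "a < b in the poset".
POP : ℕ → Set₁
POP k = Fin k → Fin k → Set

Contains : {k n : ℕ} → POP k → Vec (Fin n) n → Set
Contains {k} {n} P π =
  Σ (Fin k → Fin n) λ ι →
    (∀ (a b : Fin k) → a <ᶠ b → ι a <ᶠ ι b) ×
    (∀ (a b : Fin k) → P a b → lookup π (ι a) <ᶠ lookup π (ι b))

Avoids : {k n : ℕ} → POP k → Vec (Fin n) n → Set
Avoids P π = Contains P π → ⊥

-- λ: the POP of size 4 whose only relations are 1 > 2 and 1 > 4
-- (positions 1..4 are Fin 4 values 0..3), i.e. 2 < 1 and 4 < 1.
lam : POP 4
lam a b = (a ≡ suc zero × b ≡ zero) ⊎ (a ≡ suc (suc (suc zero)) × b ≡ zero)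

AvCount : {k : ℕ} → POP k → ℕ → ℕ → Set
AvCount P m c =
  Σ (List (Vec (Fin m) m)) λ L →
    (length L ≡ c) × Unique L × (∀ π → (π ∈ L) ⇔ (IsPerm π × Avoids P π))

-- Σ_{i=2}^{n-1} (2i-3) a_{n-i}   (j = i - 2 ranges over 0 .. n-3)
recSum : (ℕ → ℕ) → ℕ → ℕ
recSum a n = sum (map (λ j → (2 * (j + 2) ∸ 3) * a (n ∸ (j + 2))) (upTo (n ∸ 2)))

-- An occurrence of λ in π is a triple of positions i < j, j + 2 ≤ l with π_j < π_i and
-- π_l < π_i (the third position of the pattern can be anything strictly between j and l).
-- Write π = v ⊕ σ when π starts with the value v and σ is the standardisation of the rest
-- (values are 0, …, n − 1). Then π avoids λ iff σ does and σ has no two entries below v at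
-- non-adjacent positions. Such a pair always exists when v ≥ 3 and never when v ≤ 1; when
-- v = 2 it exists unless 0 and 1 are adjacent in σ. Counting the avoiders b_n of size n in
-- which 0 and 1 are adjacent in the same way (if π starts with 0 or 1, the other one must
-- come next) gives
--   a_{n+1} = 2 a_n + b_n,   b_{n+1} = 2 a_{n−1} + b_n,   b_2 = 2,
-- so b_{n+2} = 2 (a_0 + ⋯ + a_n), and the recurrence follows by induction on n: its sum is
-- the convolution of a with the odd numbers, whose increments are these partial sums.

module Submission where

open import Defs
open import Data.Empty using (⊥-elim)
open import Data.Fin using (Fin; zero; suc; toℕ; fromℕ<; punchIn; punchOut) renaming (_<_ to _<ᶠ_)
open import Data.Fin.Patterns using (0F; 1F; 2F; 3F)
open import Data.Fin.Properties
  using (toℕ-injective; toℕ<n; toℕ-fromℕ<; punchIn-injective; punchInᵢ≢i; punchIn-mono-≤;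
         punchIn-cancel-≤; punchIn-punchOut; punchOut-injective; pigeonhole; any?; ≤∧≢⇒<; <-cmp)
  renaming (_≟_ to _≟ᶠ_; <⇒≢ to <ᶠ⇒≢)
open import Data.List as List using (List; []; _∷_; length; _++_; applyUpTo)
open import Data.List.Membership.Propositional using (_∈_)
open import Data.List.Membership.Propositional.Properties using (∈-map⁺; ∈-map⁻; ++-∈⇔)
open import Data.List.Membership.Propositional.Properties.WithK using (unique∧set⇒bag)
open import Data.List.Properties using (length-map; length-++; map-upTo)
open import Data.List.Relation.Binary.BagAndSetEquality using (∼bag⇒↭)
open import Data.List.Relation.Binary.Permutation.Propositional.Properties using (↭-length)
open import Data.List.Relation.Unary.All as All using (All; [])
import Data.List.Relation.Unary.All.Properties as All
open import Data.List.Relation.Unary.AllPairs using ([]; _∷_)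
open import Data.List.Relation.Unary.Any using (here)
open import Data.List.Relation.Unary.Unique.Propositional using (Unique)
open import Data.List.Relation.Unary.Unique.Propositional.Properties using (map⁺; map⁻; ++⁺)
open import Data.Nat using (ℕ; zero; suc; _+_; _*_; _∸_; _≤_; _<_; z≤n; s≤s; s≤s⁻¹; z<s; s<s)
open import Data.Nat.ListAction using () renaming (sum to sumˡ)
open import Data.Nat.Properties
  using (+-*-semiring; +-comm; n<1+n; n<1⇒n≡0; <⇒≤; ≤-refl; ≤⇒≯; <-irrefl; <-trans; ≤-<-trans;
         <-≤-trans)
open import Algebra.Properties.Semiring.Sum +-*-semiring
  using (sum-syntax; sum-cong-≗; ∑-distrib-+; *-distribˡ-sum)
open import Data.Nat.Tactic.RingSolver using (solve-∀)
open import Data.Product using (Σ; ∃; ∃-syntax; ∃₂; _×_; _,_; proj₁)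
open import Data.Sum using (_⊎_; inj₁; inj₂; [_,_]′)
open import Data.Sum.Function.Propositional using (_⊎-⇔_)
open import Data.Vec using (Vec; []; _∷_; head; lookup; map; tabulate; toList)
open import Data.Vec.Membership.Propositional.Properties using (∈-lookup; ∈-toList⁺)
open import Data.Vec.Properties
  using (lookup-map; toList-map; tabulate-∘; tabulate-cong; tabulate∘lookup; ∷-injectiveˡ; ∷-injectiveʳ)
open import Function using (_∘_)
open import Function.Bundles using (_⇔_; mk⇔; Equivalence)
open import Function.Construct.Composition using (_⇔-∘_)
open import Function.Construct.Identity using (⇔-id)
open import Function.Construct.Symmetry using (⇔-sym)
open import Function.Definitions using (Injective)
open import Relation.Binary.Definitions using (tri<; tri≈; tri>)
open import Relation.Binary.PropositionalEquality
  using (_≡_; _≢_; _≗_; refl; sym; trans; cong; cong₂; subst; module ≡-Reasoning)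
open import Relation.Nullary using (¬_; yes; no)

open Equivalence using (to; from)

private
  variable
    A B : Set
    k m n w : ℕ

HasCount : {A : Set} → (A → Set) → ℕ → Set
HasCount {A} P c = Σ (List A) λ L → length L ≡ c × Unique L × (∀ x → x ∈ L ⇔ P x)

HasCount-unique : {P : A → Set} {c d : ℕ} → HasCount P c → HasCount P d → c ≡ d
HasCount-unique (L , refl , L! , L↔P) (K , refl , K! , K↔P) =
  ↭-length (∼bag⇒↭ (unique∧set⇒bag L! K! λ {x} → ⇔-sym (K↔P x) ⇔-∘ L↔P x))

HasCount-resp : {P Q : A → Set} {c : ℕ} → (∀ x → P x ⇔ Q x) → HasCount P c → HasCount Q c
HasCount-resp P⇔Q (L , len , L! , L↔P) = L , len , L! , λ x → P⇔Q x ⇔-∘ L↔P x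

HasCount-⊎ : {P Q : A → Set} {c d : ℕ} → HasCount P c → HasCount Q d → (∀ x → P x → ¬ Q x) →
             HasCount (λ x → P x ⊎ Q x) (c + d)
HasCount-⊎ (L , refl , L! , L↔P) (K , refl , K! , K↔Q) disjoint =
  L ++ K , length-++ L ,
  ++⁺ L! K! (λ (x∈L , x∈K) → disjoint _ (to (L↔P _) x∈L) (to (K↔Q _) x∈K)) ,
  λ x → (L↔P x ⊎-⇔ K↔Q x) ⇔-∘ ++-∈⇔

HasCount-image : {P : A → Set} {c : ℕ} (f : A → B) → Injective _≡_ _≡_ f → HasCount P c →
                 HasCount (λ y → ∃ λ x → P x × y ≡ f x) c
HasCount-image f f-inj (L , len , L! , L↔P) =
  List.map f L , trans (length-map f L) len , map⁺ f-inj L! ,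
  λ y → mk⇔ (λ y∈ → let x , x∈L , y≡ = ∈-map⁻ f y∈ in x , to (L↔P x) x∈L , y≡)
            (λ { (x , Px , refl) → ∈-map⁺ f (from (L↔P x) Px) })

Distinct : Vec A m → Set
Distinct xs = Unique (toList xs)

head∉tail : {x : A} {xs : Vec A m} → Distinct (x ∷ xs) → ∀ i → x ≢ lookup xs i
head∉tail (x∉xs ∷ _) i = All.lookup x∉xs (∈-toList⁺ (∈-lookup i _))

lookup-injective : (xs : Vec A m) → Distinct xs → ∀ i j → lookup xs i ≡ lookup xs j → i ≡ j
lookup-injective (x ∷ xs) d       zero    zero    _ = refl
lookup-injective (x ∷ xs) d       zero    (suc j) e = ⊥-elim (head∉tail d j e)
lookup-injective (x ∷ xs) d       (suc i) zero    e = ⊥-elim (head∉tail d i (sym e))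
lookup-injective (x ∷ xs) (_ ∷ d) (suc i) (suc j) e = cong suc (lookup-injective xs d i j e)

Distinct-map : (f : A → B) → Injective _≡_ _≡_ f → (xs : Vec A m) → Distinct (map f xs) ⇔ Distinct xs
Distinct-map f f-inj xs rewrite toList-map f xs = mk⇔ map⁻ (map⁺ f-inj)

map-injective : {f : A → B} → Injective _≡_ _≡_ f → Injective _≡_ _≡_ (map {n = m} f)
map-injective f-inj {[]}     {[]}     _ = refl
map-injective f-inj {x ∷ xs} {y ∷ ys} e =
  cong₂ _∷_ (f-inj (∷-injectiveˡ e)) (map-injective f-inj (∷-injectiveʳ e))

perm-surjective : (π : Vec (Fin n) n) → Distinct π → ∀ y → ∃ λ i → lookup π i ≡ y
perm-surjective {suc n} π d y with any? (λ i → lookup π i ≟ᶠ y)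
... | yes hit  = hit
... | no  miss =
  let i , j , i<j , same = pigeonhole (n<1+n n) (λ i → punchOut (y≢ i)) in
  ⊥-elim (<ᶠ⇒≢ i<j (lookup-injective π d i j (punchOut-injective (y≢ i) (y≢ j) same)))
  where
  y≢ : ∀ i → y ≢ lookup π i
  y≢ i e = miss (i , sym e)

prepend : Fin (suc n) → Vec (Fin n) m → Vec (Fin (suc n)) (suc m)
prepend v σ = v ∷ map (punchIn v) σ

punchIn-inj : (v : Fin (suc n)) → Injective _≡_ _≡_ (punchIn v)
punchIn-inj v = punchIn-injective v _ _

Distinct-prepend : (v : Fin (suc n)) (σ : Vec (Fin n) m) → Distinct (prepend v σ) ⇔ Distinct σ
Distinct-prepend v σ =
  mk⇔ (λ { (_ ∷ d) → to distinct-map d }) (λ d → v∉ ∷ from distinct-map d)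
  where
  distinct-map : Distinct (map (punchIn v) σ) ⇔ Distinct σ
  distinct-map = Distinct-map (punchIn v) (punchIn-inj v) σ
  v∉ : All (v ≢_) (toList (map (punchIn v) σ))
  v∉ rewrite toList-map (punchIn v) σ =
    All.map⁺ (All.universal (λ x → punchInᵢ≢i v x ∘ sym) (toList σ))

prepend-injective : (v : Fin (suc n)) {σ τ : Vec (Fin n) m} → prepend v σ ≡ prepend v τ → σ ≡ τ
prepend-injective v e = map-injective (punchIn-inj v) (∷-injectiveʳ e)

prepend-view : (π : Vec (Fin (suc n)) (suc m)) → Distinct π → ∃ λ σ → π ≡ prepend (head π) σ
prepend-view (x ∷ xs) d = tabulate (λ i → punchOut (head∉tail d i)) , cong (x ∷_) (sym tail≡)
  where
  open ≡-Reasoning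
  tail≡ : map (punchIn x) (tabulate (λ i → punchOut (head∉tail d i))) ≡ xs
  tail≡ = begin
    map (punchIn x) (tabulate (λ i → punchOut (head∉tail d i)))
      ≡⟨ tabulate-∘ _ _ ⟨
    tabulate (λ i → punchIn x (punchOut (head∉tail d i)))
      ≡⟨ tabulate-cong (punchIn-punchOut ∘ head∉tail d) ⟩
    tabulate (lookup xs)
      ≡⟨ tabulate∘lookup xs ⟩
    xs ∎

Prepended : Fin (suc n) → (Vec (Fin n) n → Set) → Vec (Fin (suc n)) (suc n) → Set
Prepended v P π = ∃ λ σ → P σ × π ≡ prepend v σ

prepended-view : {Q : Vec (Fin (suc n)) (suc n) → Set} → (∀ {π} → Q π → Distinct π) →
                 ∀ π → Q π ⇔ ∃ λ v → Prepended v (Q ∘ prepend v) π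
prepended-view {Q = Q} Q-distinct π = mk⇔ split join
  where
  split : Q π → ∃ λ v → Prepended v (Q ∘ prepend v) π
  split q = let σ , π≡ = prepend-view π (Q-distinct q) in head π , σ , subst Q π≡ q , π≡
  join : (∃ λ v → Prepended v (Q ∘ prepend v) π) → Q π
  join (_ , _ , q , π≡) = subst Q (sym π≡) q

prepended-disjoint : {P R : Vec (Fin n) n → Set} {v v′ : Fin (suc n)} {π : Vec (Fin (suc n)) (suc n)} →
                     v ≢ v′ → Prepended v P π → ¬ Prepended v′ R π
prepended-disjoint v≢v′ (_ , _ , π≡) (_ , _ , π≡′) = v≢v′ (cong head (trans (sym π≡) π≡′))

HasCount-prepended : {P : Vec (Fin n) n → Set} {c : ℕ} (v : Fin (suc n)) →
                     HasCount P c → HasCount (Prepended v P) c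
HasCount-prepended v = HasCount-image (prepend v) (prepend-injective v)

module _ {Q : Vec (Fin 2) 2 → Set} (Q-distinct : ∀ {π} → Q π → Distinct π) where

  HasCount-byHead₂ : ∀ {a b} → HasCount (Q ∘ prepend 0F) a → HasCount (Q ∘ prepend 1F) b →
                     HasCount Q (a + b)
  HasCount-byHead₂ count₀ count₁ =
    HasCount-resp (λ π → ⇔-sym (heads π))
      (HasCount-⊎ (HasCount-prepended 0F count₀) (HasCount-prepended 1F count₁)
                  (λ _ → prepended-disjoint λ ()))
    where
    heads : ∀ π → Q π ⇔ (Prepended 0F (Q ∘ prepend 0F) π ⊎ Prepended 1F (Q ∘ prepend 1F) π)
    heads π = mk⇔ split [ (0F ,_) , (1F ,_) ]′ ⇔-∘ prepended-view Q-distinct π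
      where
      split : (∃ λ v → Prepended v (Q ∘ prepend v) π) →
              Prepended 0F (Q ∘ prepend 0F) π ⊎ Prepended 1F (Q ∘ prepend 1F) π
      split (0F , p) = inj₁ p
      split (1F , p) = inj₂ p

module _ {Q : Vec (Fin (3 + k)) (3 + k) → Set} (Q-distinct : ∀ {π} → Q π → Distinct π)
         (Q-head<3 : ∀ v σ → 3 ≤ toℕ v → ¬ Q (prepend v σ)) where

  HasCount-byHead₃ : ∀ {a b c} → HasCount (Q ∘ prepend 0F) a → HasCount (Q ∘ prepend 1F) b →
                     HasCount (Q ∘ prepend 2F) c → HasCount Q (a + (b + c))
  HasCount-byHead₃ count₀ count₁ count₂ =
    HasCount-resp (λ π → ⇔-sym (heads π))
      (HasCount-⊎ (HasCount-prepended 0F count₀)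
                  (HasCount-⊎ (HasCount-prepended 1F count₁) (HasCount-prepended 2F count₂)
                              (λ _ → prepended-disjoint λ ()))
                  (λ _ p → [ prepended-disjoint (λ ()) p , prepended-disjoint (λ ()) p ]′))
    where
    Heads : Vec (Fin (3 + k)) (3 + k) → Set
    Heads π = Prepended 0F (Q ∘ prepend 0F) π
            ⊎ (Prepended 1F (Q ∘ prepend 1F) π ⊎ Prepended 2F (Q ∘ prepend 2F) π)
    heads : ∀ π → Q π ⇔ Heads π
    heads π = mk⇔ split [ (0F ,_) , [ (1F ,_) , (2F ,_) ]′ ]′ ⇔-∘ prepended-view Q-distinct π
      where
      split : (∃ λ v → Prepended v (Q ∘ prepend v) π) → Heads π
      split (0F , p) = inj₁ p
      split (1F , p) = inj₂ (inj₁ p)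
      split (2F , p) = inj₂ (inj₂ p)
      split (v@(suc (suc (suc _))) , σ , q , _) = ⊥-elim (Q-head<3 v σ (s≤s (s≤s (s≤s z≤n))) q)

punchIn-<⇔ : (v : Fin (suc n)) (a b : Fin n) → punchIn v a <ᶠ punchIn v b ⇔ a <ᶠ b
punchIn-<⇔ v a b = mk⇔
  (λ p → ≤∧≢⇒< (punchIn-cancel-≤ v a b (<⇒≤ p)) (<ᶠ⇒≢ p ∘ cong (punchIn v)))
  (λ p → ≤∧≢⇒< (punchIn-mono-≤ v a b (<⇒≤ p)) (<ᶠ⇒≢ p ∘ punchIn-injective v a b))

punchIn-below : (v : Fin (suc n)) (x : Fin n) → w ≤ toℕ v → toℕ (punchIn v x) < w ⇔ toℕ x < w
punchIn-below zero    x       z≤n = mk⇔ (λ ()) (λ ())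
punchIn-below (suc v) zero    _   = ⇔-id _
punchIn-below {w = zero}  (suc v) (suc x) _ = mk⇔ (λ ()) (λ ())
punchIn-below {w = suc w} (suc v) (suc x) (s≤s w≤v) =
  mk⇔ (s<s ∘ to below ∘ s≤s⁻¹) (s<s ∘ from below ∘ s≤s⁻¹)
  where
  below : toℕ (punchIn v x) < w ⇔ toℕ x < w
  below = punchIn-below v x w≤v

punchIn-<2⇔ : (v : Fin (2 + n)) (y : Fin (suc n)) → toℕ v < 2 → toℕ (punchIn v y) < 2 ⇔ y ≡ 0F
punchIn-<2⇔ 0F            0F      _ = mk⇔ (λ _ → refl) (λ _ → s<s (s<s z≤n))
punchIn-<2⇔ 1F            0F      _ = mk⇔ (λ _ → refl) (λ _ → z<s)
punchIn-<2⇔ 0F            (suc y) _ = mk⇔ (λ { (s<s (s<s ())) }) (λ ())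
punchIn-<2⇔ 1F            (suc y) _ = mk⇔ (λ { (s<s (s<s ())) }) (λ ())
punchIn-<2⇔ (suc (suc v)) _       (s<s (s<s ()))

Occurrence : Vec (Fin k) m → Set
Occurrence π = ∃[ i ] ∃[ j ] ∃[ l ]
  i <ᶠ j × suc (toℕ j) < toℕ l × lookup π j <ᶠ lookup π i × lookup π l <ᶠ lookup π i

contains⇔occurrence : (π : Vec (Fin n) n) → Contains lam π ⇔ Occurrence π
contains⇔occurrence {n} π = mk⇔ occurrence embedding
  where
  occurrence : Contains lam π → Occurrence π
  occurrence (ι , ι-mono , ι-rel) =
    ι 0F , ι 1F , ι 3F , ι-mono 0F 1F z<s ,
    ≤-<-trans (ι-mono 1F 2F (s<s z<s)) (ι-mono 2F 3F (s<s (s<s z<s))) ,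
    ι-rel 1F 0F (inj₁ (refl , refl)) , ι-rel 3F 0F (inj₂ (refl , refl))

  embedding : Occurrence π → Contains lam π
  embedding (i , j , l , i<j , j+1<l , πj<πi , πl<πi) = ι , ι-mono , ι-rel
    where
    j+1 : Fin n
    j+1 = fromℕ< (<-trans j+1<l (toℕ<n l))
    j<j+1 : j <ᶠ j+1
    j<j+1 = subst (toℕ j <_) (sym (toℕ-fromℕ< _)) (n<1+n _)
    j+1<l′ : j+1 <ᶠ l
    j+1<l′ = subst (_< toℕ l) (sym (toℕ-fromℕ< _)) j+1<l
    ι : Fin 4 → Fin n
    ι 0F = i
    ι 1F = j
    ι 2F = j+1
    ι 3F = l
    ι-mono : ∀ a b → a <ᶠ b → ι a <ᶠ ι b
    ι-mono 0F 1F _ = i<j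
    ι-mono 0F 2F _ = <-trans i<j j<j+1
    ι-mono 0F 3F _ = <-trans i<j (<-trans j<j+1 j+1<l′)
    ι-mono 1F 2F _ = j<j+1
    ι-mono 1F 3F _ = <-trans j<j+1 j+1<l′
    ι-mono 2F 3F _ = j+1<l′
    ι-mono _ 0F ()
    ι-mono (suc _) 1F (s<s ())
    ι-mono (suc (suc _)) 2F (s<s (s<s ()))
    ι-mono (suc (suc (suc _))) 3F (s<s (s<s (s<s ())))
    ι-rel : ∀ a b → lam a b → lookup π (ι a) <ᶠ lookup π (ι b)
    ι-rel _ _ (inj₁ (refl , refl)) = πj<πi
    ι-rel _ _ (inj₂ (refl , refl)) = πl<πi

NonAdjacentBelow : ℕ → Vec (Fin k) m → Set
NonAdjacentBelow w σ = ∃[ j ] ∃[ l ]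
  suc (toℕ j) < toℕ l × toℕ (lookup σ j) < w × toℕ (lookup σ l) < w

occurrence-∷ : (x : Fin k) (τ : Vec (Fin k) m) →
               Occurrence (x ∷ τ) ⇔ (NonAdjacentBelow (toℕ x) τ ⊎ Occurrence τ)
occurrence-∷ x τ = mk⇔ split join
  where
  split : Occurrence (x ∷ τ) → NonAdjacentBelow (toℕ x) τ ⊎ Occurrence τ
  split (zero  , suc j , suc l , _       , s<s j+1<l , p , q) = inj₁ (j , l , j+1<l , p , q)
  split (suc i , suc j , suc l , s<s i<j , s<s j+1<l , p , q) = inj₂ (i , j , l , i<j , j+1<l , p , q)
  split (_ , zero , _ , () , _)
  split (_ , suc _ , zero , _ , () , _)
  join : NonAdjacentBelow (toℕ x) τ ⊎ Occurrence τ → Occurrence (x ∷ τ)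
  join (inj₁ (j , l , j+1<l , p , q))         = zero , suc j , suc l , z<s , s<s j+1<l , p , q
  join (inj₂ (i , j , l , i<j , j+1<l , p , q)) = suc i , suc j , suc l , s<s i<j , s<s j+1<l , p , q

occurrence-map : {k′ : ℕ} (f : Fin k → Fin k′) → (∀ a b → f a <ᶠ f b ⇔ a <ᶠ b) →
                 (σ : Vec (Fin k) m) → Occurrence (map f σ) ⇔ Occurrence σ
occurrence-map f f-< σ = mk⇔
  (λ (i , j , l , i<j , j+1<l , p , q) →
     i , j , l , i<j , j+1<l , to (entry-< j i) p , to (entry-< l i) q)
  (λ (i , j , l , i<j , j+1<l , p , q) →
     i , j , l , i<j , j+1<l , from (entry-< j i) p , from (entry-< l i) q)
  where
  entry-< : ∀ a b → lookup (map f σ) a <ᶠ lookup (map f σ) b ⇔ lookup σ a <ᶠ lookup σ b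
  entry-< a b rewrite lookup-map a f σ | lookup-map b f σ = f-< _ _

nonAdjacentBelow-map : {k′ : ℕ} (f : Fin k → Fin k′) → (∀ x → toℕ (f x) < w ⇔ toℕ x < w) →
                       (σ : Vec (Fin k) m) → NonAdjacentBelow w (map f σ) ⇔ NonAdjacentBelow w σ
nonAdjacentBelow-map {w = w} f f-below σ = mk⇔
  (λ (j , l , j+1<l , p , q) → j , l , j+1<l , to (entry-below j) p , to (entry-below l) q)
  (λ (j , l , j+1<l , p , q) → j , l , j+1<l , from (entry-below j) p , from (entry-below l) q)
  where
  entry-below : ∀ a → toℕ (lookup (map f σ) a) < w ⇔ toℕ (lookup σ a) < w
  entry-below a rewrite lookup-map a f σ = f-below _

nonAdjacentBelow-∷ : (x : Fin k) (τ : Vec (Fin k) m) → w ≤ toℕ x →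
                     NonAdjacentBelow w (x ∷ τ) ⇔ NonAdjacentBelow w τ
nonAdjacentBelow-∷ x τ w≤x = mk⇔
  (λ { (zero , _ , _ , x<w , _) → ⊥-elim (≤⇒≯ w≤x x<w)
     ; (suc j , zero , () , _)
     ; (suc j , suc l , s<s j+1<l , p , q) → j , l , j+1<l , p , q })
  (λ (j , l , j+1<l , p , q) → suc j , suc l , s<s j+1<l , p , q)

occurrence-prepend : (v : Fin (suc n)) (σ : Vec (Fin n) m) →
                     Occurrence (prepend v σ) ⇔ (NonAdjacentBelow (toℕ v) σ ⊎ Occurrence σ)
occurrence-prepend v σ =
  (nonAdjacentBelow-map (punchIn v) (λ x → punchIn-below v x ≤-refl) σ
    ⊎-⇔ occurrence-map (punchIn v) (punchIn-<⇔ v) σ)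
  ⇔-∘ occurrence-∷ v (map (punchIn v) σ)

nonAdjacentBelow-prepend : (v : Fin (suc n)) (σ : Vec (Fin n) m) → w ≤ toℕ v →
                           NonAdjacentBelow w (prepend v σ) ⇔ NonAdjacentBelow w σ
nonAdjacentBelow-prepend v σ w≤v =
  nonAdjacentBelow-map (punchIn v) (λ x → punchIn-below v x w≤v) σ
  ⇔-∘ nonAdjacentBelow-∷ v (map (punchIn v) σ) w≤v

¬nonAdjacentBelow-≤1 : (σ : Vec (Fin k) m) → Distinct σ → w ≤ 1 → ¬ NonAdjacentBelow w σ
¬nonAdjacentBelow-≤1 {w = w} σ d w≤1 (j , l , j+1<l , σj<w , σl<w) =
  <-irrefl (cong toℕ j≡l) (<-trans (n<1+n _) j+1<l)
  where
  entry≡0 : ∀ i → toℕ (lookup σ i) < w → toℕ (lookup σ i) ≡ 0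
  entry≡0 i p = n<1⇒n≡0 (<-≤-trans p w≤1)
  j≡l : j ≡ l
  j≡l = lookup-injective σ d j l (toℕ-injective (trans (entry≡0 j σj<w) (sym (entry≡0 l σl<w))))

nonAdjacent-of-three : {Q : Fin m → Set} (a b c : Fin m) → a ≢ b → b ≢ c → a ≢ c →
                       Q a → Q b → Q c → ∃₂ λ j l → suc (toℕ j) < toℕ l × Q j × Q l
nonAdjacent-of-three a b c a≢b b≢c a≢c qa qb qc with <-cmp a b | <-cmp b c | <-cmp a c
... | tri≈ _ a≡b _ | _            | _            = ⊥-elim (a≢b a≡b)
... | _            | tri≈ _ b≡c _ | _            = ⊥-elim (b≢c b≡c)
... | _            | _            | tri≈ _ a≡c _ = ⊥-elim (a≢c a≡c)
... | tri< a<b _ _ | tri< b<c _ _ | _            = a , c , ≤-<-trans a<b b<c , qa , qc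
... | tri< a<b _ _ | tri> _ _ c<b | tri< a<c _ _ = a , b , ≤-<-trans a<c c<b , qa , qb
... | tri< a<b _ _ | tri> _ _ c<b | tri> _ _ c<a = c , b , ≤-<-trans c<a a<b , qc , qb
... | tri> _ _ b<a | tri< b<c _ _ | tri< a<c _ _ = b , c , ≤-<-trans b<a a<c , qb , qc
... | tri> _ _ b<a | tri< b<c _ _ | tri> _ _ c<a = b , a , ≤-<-trans b<c c<a , qb , qa
... | tri> _ _ b<a | tri> _ _ c<b | _            = c , a , ≤-<-trans c<b b<a , qc , qa

-- The values 0, 1 and 2 sit at three distinct positions, two of which are not adjacent.
nonAdjacentBelow-≥3 : (σ : Vec (Fin (3 + n)) (3 + n)) → Distinct σ → 3 ≤ w → NonAdjacentBelow w σ
nonAdjacentBelow-≥3 {w = w} σ d 3≤w =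
  let p₀ , σp₀ = perm-surjective σ d 0F
      p₁ , σp₁ = perm-surjective σ d 1F
      p₂ , σp₂ = perm-surjective σ d 2F
  in nonAdjacent-of-three p₀ p₁ p₂ (apart σp₀ σp₁ λ ()) (apart σp₁ σp₂ λ ()) (apart σp₀ σp₂ λ ())
       (below σp₀ z<s) (below σp₁ (s<s z<s)) (below σp₂ (s<s (s<s z<s)))
  where
  apart : ∀ {p q x y} → lookup σ p ≡ x → lookup σ q ≡ y → x ≢ y → p ≢ q
  apart σp σq x≢y p≡q = x≢y (trans (sym σp) (trans (cong (lookup σ) p≡q) σq))
  below : ∀ {p x} → lookup σ p ≡ x → toℕ x < 3 → toℕ (lookup σ p) < w
  below σp x<3 = subst (λ y → toℕ y < w) (sym σp) (<-≤-trans x<3 3≤w)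

¬nonAdjacentBelow₂-prepend⇔ : (v : Fin (2 + n)) → toℕ v < 2 → (σ : Vec (Fin (suc n)) (suc n)) →
                              Distinct σ → (¬ NonAdjacentBelow 2 (prepend v σ)) ⇔ head σ ≡ 0F
¬nonAdjacentBelow₂-prepend⇔ v v<2 σ@(x ∷ τ) d = mk⇔ zero-first adjacent
  where
  entry<2⇔ : ∀ i → toℕ (lookup (map (punchIn v) τ) i) < 2 ⇔ lookup τ i ≡ 0F
  entry<2⇔ i rewrite lookup-map i (punchIn v) τ = punchIn-<2⇔ v (lookup τ i) v<2
  zero-first : ¬ NonAdjacentBelow 2 (prepend v σ) → x ≡ 0F
  zero-first ¬nab with perm-surjective σ d 0F
  ... | zero  , x≡0  = x≡0
  ... | suc p , τp≡0 = ⊥-elim (¬nab (zero , suc (suc p) , s≤s (s≤s z≤n) , v<2 , from (entry<2⇔ p) τp≡0))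
  adjacent : x ≡ 0F → ¬ NonAdjacentBelow 2 (prepend v σ)
  adjacent x≡0 (_ , suc (suc l) , _ , _ , τl<2) = head∉tail d l (trans x≡0 (sym (to (entry<2⇔ l) τl<2)))
  adjacent x≡0 (_ , zero , () , _)
  adjacent x≡0 (_ , suc zero , s<s () , _)

Avoider : Vec (Fin n) n → Set
Avoider π = Distinct π × ¬ Occurrence π

avoider⇔ : (π : Vec (Fin n) n) → (IsPerm π × Avoids lam π) ⇔ Avoider π
avoider⇔ π = mk⇔ (λ (d , ¬c) → d , ¬c ∘ from occ) (λ (d , ¬o) → d , ¬o ∘ to occ)
  where
  occ : Contains lam π ⇔ Occurrence π
  occ = contains⇔occurrence π

avoider-prepend : (v : Fin (suc n)) (σ : Vec (Fin n) n) →
                  Avoider (prepend v σ) ⇔ (Avoider σ × ¬ NonAdjacentBelow (toℕ v) σ)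
avoider-prepend v σ = mk⇔
  (λ (d , ¬o) → (to (Distinct-prepend v σ) d , ¬o ∘ from occ ∘ inj₂) , ¬o ∘ from occ ∘ inj₁)
  (λ ((d , ¬o) , ¬nab) → from (Distinct-prepend v σ) d , [ ¬nab , ¬o ]′ ∘ to occ)
  where
  occ : Occurrence (prepend v σ) ⇔ (NonAdjacentBelow (toℕ v) σ ⊎ Occurrence σ)
  occ = occurrence-prepend v σ

avoider-prepend-low : (v : Fin (suc n)) (σ : Vec (Fin n) n) → toℕ v ≤ 1 →
                      Avoider (prepend v σ) ⇔ Avoider σ
avoider-prepend-low v σ v≤1 = mk⇔
  (proj₁ ∘ to (avoider-prepend v σ))
  (λ a → from (avoider-prepend v σ) (a , ¬nonAdjacentBelow-≤1 σ (proj₁ a) v≤1))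

¬avoider-prepend-high : (v : Fin (suc n)) (σ : Vec (Fin n) n) → 3 ≤ toℕ v → ¬ Avoider (prepend v σ)
¬avoider-prepend-high {suc (suc (suc _))} v σ 3≤v a =
  let (d , _) , ¬nab = to (avoider-prepend v σ) a in ¬nab (nonAdjacentBelow-≥3 σ d 3≤v)
¬avoider-prepend-high {0} 0F _ ()
¬avoider-prepend-high {1} (suc 0F) _ (s≤s ())
¬avoider-prepend-high {2} (suc (suc 0F)) _ (s≤s (s≤s ()))

-- The permutations counted by b_n in the header: 0 and 1 are adjacent.
AvoiderAdj : Vec (Fin n) n → Set
AvoiderAdj π = Avoider π × ¬ NonAdjacentBelow 2 π

avoiderAdj-prepend-2 : (σ : Vec (Fin (2 + n)) (2 + n)) → AvoiderAdj (prepend 2F σ) ⇔ AvoiderAdj σ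
avoiderAdj-prepend-2 σ = mk⇔
  (to (avoider-prepend 2F σ) ∘ proj₁)
  (λ a@(_ , ¬nab) → from (avoider-prepend 2F σ) a , ¬nab ∘ to (nonAdjacentBelow-prepend 2F σ ≤-refl))

avoiderAdj-prepend-low : (v : Fin (2 + n)) (σ : Vec (Fin (suc n)) (suc n)) → toℕ v < 2 →
                         AvoiderAdj (prepend v σ) ⇔ (Avoider σ × head σ ≡ 0F)
avoiderAdj-prepend-low v σ v<2 = mk⇔
  (λ (a , ¬nab) → let aσ = to low a in aσ , to (adjacent aσ) ¬nab)
  (λ (aσ , σ₀≡0) → from low aσ , from (adjacent aσ) σ₀≡0)
  where
  low : Avoider (prepend v σ) ⇔ Avoider σ
  low = avoider-prepend-low v σ (s≤s⁻¹ v<2)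
  adjacent : Avoider σ → (¬ NonAdjacentBelow 2 (prepend v σ)) ⇔ head σ ≡ 0F
  adjacent (d , _) = ¬nonAdjacentBelow₂-prepend⇔ v v<2 σ d

startsWithZero⇔ : (σ : Vec (Fin (suc n)) (suc n)) → (Avoider σ × head σ ≡ 0F) ⇔ Prepended 0F Avoider σ
startsWithZero⇔ σ = mk⇔ split join
  where
  split : Avoider σ × head σ ≡ 0F → Prepended 0F Avoider σ
  split (a , σ₀≡0) =
    let τ , σ≡ = prepend-view σ (proj₁ a)
        σ≡0τ = trans σ≡ (cong (λ u → prepend u τ) σ₀≡0)
    in τ , to (avoider-prepend-low 0F τ z≤n) (subst Avoider σ≡0τ a) , σ≡0τ
  join : Prepended 0F Avoider σ → Avoider σ × head σ ≡ 0F
  join (τ , a , σ≡) = subst Avoider (sym σ≡) (from (avoider-prepend-low 0F τ z≤n) a) , cong head σ≡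

HasCount-Avoider-prepend-low : {c : ℕ} (v : Fin (suc n)) → toℕ v ≤ 1 → HasCount (Avoider {n}) c →
                               HasCount (Avoider ∘ prepend v) c
HasCount-Avoider-prepend-low v v≤1 = HasCount-resp (λ σ → ⇔-sym (avoider-prepend-low v σ v≤1))

HasCount-AvoiderAdj-prepend-low : {c : ℕ} (v : Fin (2 + n)) → toℕ v < 2 → HasCount (Avoider {n}) c →
                                  HasCount (AvoiderAdj ∘ prepend v) c
HasCount-AvoiderAdj-prepend-low v v<2 count =
  HasCount-resp (λ σ → ⇔-sym (startsWithZero⇔ σ ⇔-∘ avoiderAdj-prepend-low v σ v<2))
                (HasCount-prepended 0F count)

-- #Av n = a_n and #AvAdj k = b_{k+2}.
#Av : ℕ → ℕ
#AvAdj : ℕ → ℕ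

#Av 0 = 1
#Av 1 = 1
#Av 2 = 2
#Av (suc (suc (suc k))) = #Av (suc (suc k)) + (#Av (suc (suc k)) + #AvAdj k)

#AvAdj zero    = 2
#AvAdj (suc k) = #Av (suc k) + (#Av (suc k) + #AvAdj k)

avoiders₀-count : HasCount (Avoider {0}) 1
avoiders₀-count =
  [] ∷ [] , refl , [] ∷ [] , λ { [] → mk⇔ (λ _ → [] , λ { (() , _) }) (λ _ → here refl) }

avoiders₁-count : HasCount (Avoider {1}) 1
avoiders₁-count =
  HasCount-resp (λ π → ⇔-sym (heads π))
    (HasCount-prepended 0F (HasCount-Avoider-prepend-low 0F z≤n avoiders₀-count))
  where
  heads : (π : Vec (Fin 1) 1) → Avoider π ⇔ Prepended 0F (Avoider ∘ prepend 0F) π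
  heads π = mk⇔ (λ { (0F , p) → p ; (suc () , _) }) (0F ,_) ⇔-∘ prepended-view {Q = Avoider} proj₁ π

avoiders₂-count : HasCount (Avoider {2}) 2
avoiders₂-count =
  HasCount-byHead₂ proj₁ (HasCount-Avoider-prepend-low 0F z≤n avoiders₁-count)
                         (HasCount-Avoider-prepend-low 1F (s≤s z≤n) avoiders₁-count)

avoiders-count : ∀ n → HasCount (Avoider {n}) (#Av n)
avoidersAdj-count : ∀ k → HasCount (AvoiderAdj {2 + k}) (#AvAdj k)

avoiders-count 0 = avoiders₀-count
avoiders-count 1 = avoiders₁-count
avoiders-count 2 = avoiders₂-count
avoiders-count (suc (suc (suc k))) =
  HasCount-byHead₃ proj₁ ¬avoider-prepend-high
    (HasCount-Avoider-prepend-low 0F z≤n (avoiders-count (suc (suc k))))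
    (HasCount-Avoider-prepend-low 1F (s≤s z≤n) (avoiders-count (suc (suc k))))
    (HasCount-resp (λ σ → ⇔-sym (avoider-prepend 2F σ)) (avoidersAdj-count k))

avoidersAdj-count zero = HasCount-resp (λ π → mk⇔ (_, short π) proj₁) avoiders₂-count
  where
  short : (π : Vec (Fin 2) 2) → ¬ NonAdjacentBelow 2 π
  short π (_ , zero , () , _)
  short π (_ , suc zero , s<s () , _)
avoidersAdj-count (suc k) =
  HasCount-byHead₃ (proj₁ ∘ proj₁) (λ v σ 3≤v → ¬avoider-prepend-high v σ 3≤v ∘ proj₁)
    (HasCount-AvoiderAdj-prepend-low 0F z<s (avoiders-count (suc k)))
    (HasCount-AvoiderAdj-prepend-low 1F (s<s z<s) (avoiders-count (suc k)))
    (HasCount-resp (λ σ → ⇔-sym (avoiderAdj-prepend-2 σ)) (avoidersAdj-count k))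

oddConvolution : (ℕ → ℕ) → ℕ → ℕ
oddConvolution f m = ∑[ j < m ] ((1 + 2 * toℕ j) * f (m ∸ toℕ j))

oddConvolution-cong : {f g : ℕ → ℕ} → f ≗ g → ∀ m → oddConvolution f m ≡ oddConvolution g m
oddConvolution-cong f≗g m = sum-cong-≗ {m} (λ j → cong ((1 + 2 * toℕ j) *_) (f≗g (m ∸ toℕ j)))

sumFrom1To : (ℕ → ℕ) → ℕ → ℕ
sumFrom1To f m = ∑[ j < m ] f (m ∸ toℕ j)

oddConvolution-suc : ∀ f m → oddConvolution f (suc m) ≡ f (suc m) + oddConvolution f m + 2 * sumFrom1To f m
oddConvolution-suc f m = begin
  oddConvolution f (suc m)
    ≡⟨⟩
  leading + ∑[ j < m ] ((1 + 2 * suc (toℕ j)) * f (m ∸ toℕ j))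
    ≡⟨ cong (leading +_) (sum-cong-≗ {m} λ j → split (toℕ j) (f (m ∸ toℕ j))) ⟩
  leading + ∑[ j < m ] (oddTerm j + 2 * f (m ∸ toℕ j))
    ≡⟨ cong (leading +_) (∑-distrib-+ {m} oddTerm (λ j → 2 * f (m ∸ toℕ j))) ⟩
  leading + (oddConvolution f m + ∑[ j < m ] (2 * f (m ∸ toℕ j)))
    ≡⟨ cong (λ s → leading + (oddConvolution f m + s)) (*-distribˡ-sum {m} 2 (λ j → f (m ∸ toℕ j))) ⟨
  leading + (oddConvolution f m + 2 * sumFrom1To f m)
    ≡⟨ regroup (f (suc m)) (oddConvolution f m) (sumFrom1To f m) ⟩
  f (suc m) + oddConvolution f m + 2 * sumFrom1To f m ∎
  where
  open ≡-Reasoning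
  leading : ℕ
  leading = (1 + 2 * 0) * f (suc m)
  oddTerm : Fin m → ℕ
  oddTerm j = (1 + 2 * toℕ j) * f (m ∸ toℕ j)
  split : ∀ j x → (1 + 2 * suc j) * x ≡ (1 + 2 * j) * x + 2 * x
  split = solve-∀
  regroup : ∀ x c s → (1 + 2 * 0) * x + (c + 2 * s) ≡ x + c + 2 * s
  regroup = solve-∀

#AvAdj≡partialSums : ∀ m → #AvAdj m ≡ 2 + 2 * sumFrom1To #Av m
#AvAdj≡partialSums zero    = refl
#AvAdj≡partialSums (suc m) =
  trans (cong (λ b → #Av (suc m) + (#Av (suc m) + b)) (#AvAdj≡partialSums m))
        (regroup (#Av (suc m)) (sumFrom1To #Av m))
  where
  regroup : ∀ a s → a + (a + (2 + 2 * s)) ≡ 2 + 2 * (a + s)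
  regroup = solve-∀

#Av-recurrence : ∀ m → #Av (2 + m) ≡ (1 + 2 * m) + #Av (1 + m) + oddConvolution #Av m
#Av-recurrence zero    = refl
#Av-recurrence (suc m) = begin
  #Av (3 + m)
    ≡⟨⟩
  #Av (2 + m) + (#Av (2 + m) + #AvAdj m)
    ≡⟨ cong₂ (λ a b → #Av (2 + m) + (a + b)) (#Av-recurrence m) (#AvAdj≡partialSums m) ⟩
  #Av (2 + m) + ((1 + 2 * m) + #Av (1 + m) + oddConvolution #Av m + (2 + 2 * S))
    ≡⟨ regroup m (#Av (2 + m)) (#Av (1 + m)) (oddConvolution #Av m) S ⟩
  (1 + 2 * suc m) + #Av (2 + m) + (#Av (1 + m) + oddConvolution #Av m + 2 * S)
    ≡⟨ cong ((1 + 2 * suc m) + #Av (2 + m) +_) (oddConvolution-suc #Av m) ⟨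
  (1 + 2 * suc m) + #Av (2 + m) + oddConvolution #Av (suc m) ∎
  where
  open ≡-Reasoning
  S : ℕ
  S = sumFrom1To #Av m
  regroup : ∀ m a b c s →
            a + ((1 + 2 * m) + b + c + (2 + 2 * s)) ≡ (1 + 2 * suc m) + a + (b + c + 2 * s)
  regroup = solve-∀

sum-applyUpTo : ∀ (g : ℕ → ℕ) n → sumˡ (applyUpTo g n) ≡ ∑[ j < n ] g (toℕ j)
sum-applyUpTo g zero    = refl
sum-applyUpTo g (suc n) = cong (g 0 +_) (sum-applyUpTo (g ∘ suc) n)

odd-coefficient : ∀ j → 2 * (2 + j) ∸ 3 ≡ 1 + 2 * j
odd-coefficient j = cong (_∸ 3) (double j)
  where
  double : ∀ j → 2 * (2 + j) ≡ 3 + (1 + 2 * j)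
  double = solve-∀

recSum≡oddConvolution : ∀ f m → recSum f (2 + m) ≡ oddConvolution f m
recSum≡oddConvolution f m = begin
  recSum f (2 + m)                                             ≡⟨ cong sumˡ (map-upTo _ m) ⟩
  sumˡ (applyUpTo _ m)                                         ≡⟨ sum-applyUpTo _ m ⟩
  ∑[ j < m ] ((2 * (toℕ j + 2) ∸ 3) * f (2 + m ∸ (toℕ j + 2))) ≡⟨ sum-cong-≗ {m} (term ∘ toℕ) ⟩
  oddConvolution f m                                           ∎
  where
  open ≡-Reasoning
  term : ∀ j → (2 * (j + 2) ∸ 3) * f (2 + m ∸ (j + 2)) ≡ (1 + 2 * j) * f (m ∸ j)
  term j = trans (cong (λ i → (2 * i ∸ 3) * f (2 + m ∸ i)) (+-comm j 2))
                 (cong (_* f (m ∸ j)) (odd-coefficient j))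

mainTheorem1 : (a : ℕ → ℕ) → (∀ m → AvCount lam m (a m)) →
    ∀ n → 4 ≤ n → a n ≡ (2 * n ∸ 3) + a (n ∸ 1) + recSum a n
mainTheorem1 a counts _ (s≤s (s≤s (s≤s (s≤s {n = k} _)))) = begin
  a (4 + k)                                                     ≡⟨ a≗#Av (4 + k) ⟩
  #Av (4 + k)                                                   ≡⟨ #Av-recurrence (2 + k) ⟩
  (1 + 2 * (2 + k)) + #Av (3 + k) + oddConvolution #Av (2 + k)
    ≡⟨ cong₂ _+_ (cong₂ _+_ (odd-coefficient (2 + k)) (a≗#Av (3 + k)))
                 (oddConvolution-cong a≗#Av (2 + k)) ⟨
  (2 * (4 + k) ∸ 3) + a (3 + k) + oddConvolution a (2 + k)
    ≡⟨ cong ((2 * (4 + k) ∸ 3) + a (3 + k) +_) (recSum≡oddConvolution a (2 + k)) ⟨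
  (2 * (4 + k) ∸ 3) + a (3 + k) + recSum a (4 + k)              ∎
  where
  open ≡-Reasoning
  a≗#Av : a ≗ #Av
  a≗#Av m = HasCount-unique (HasCount-resp (avoider⇔ {m}) (counts m)) (avoiders-count m)
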